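{- Let $x,y\in\Sigma^n$ and let $G_{x,y}$ be the grid graph defined in the context, with cost function $c$. If vertex $(i,d)$ (with $i<n$, and $(i,d)$, $(i+1,d)$ reachable from $(0,0)$) is non-potent, then $c(i+1,d)=c(i,d)$.
   Context: Grid graph $G_{x,y}$: vertex set $[0..n]\times[-n..n]$ (a vertex $(i,d)$ has row $i$ and diagonal $d$), with the following weighted edges whenever both endpoints are vertices: deletion edges $(i,d)\to(i+1,d-1)$ of weight $1$; insertion edges $(i,d)\to(i,d+1)$ of weight $1$; matching/substitution edges $(i,d)\to(i+1,d)$ (present when $1\le i+d+1\le n$) of weight $0$ if $x_{i+1}=y_{i+d+1}$ and $1$ otherwise. $c(i,d)$ is the minimum weight of a path from $(0,0)$ to $(i,d)$. Diagonal $d$ has a match at row $i$ if $x_i=y_{i+d}$ and a mismatch if $x_i\neq y_{i+d}$. A vertex $(i,d)$ with $h=c(i,d)$ is dominated by an in-neighbor $(i,d-1)$ or $(i-1,d+1)$ if that in-neighbor has cost $h-1$. Potent (defined recursively in lexicographic order of (row, diagonal)): vertex $(i,d)$ is potent if (a) whenever $(i,d)$ is dominated by $(i,d-1)$, vertex $(i,d-1)$ is potent and diagonal $d-1$ has a mismatch at row $i+1$; and (b) whenever $(i,d)$ is dominated by $(i-1,d+1)$, vertex $(i-1,d+1)$ is potent and diagonal $d+1$ has a mismatch at row $i$. A non-dominated vertex is potent. Nonexistent objects are ignored. -}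

module Defs where

open import Data.Nat as ℕ using (ℕ; zero; suc; _≤_)
open import Data.Integer as ℤ using (ℤ; +_; -[1+_]; +[1+_])
open import Data.Vec using (Vec; []; _∷_)
open import Data.Maybe using (Maybe; just; nothing)
open import Data.Product using (Σ; _×_; ∃)
open import Relation.Nullary using (¬_)
open import Relation.Binary.PropositionalEquality using (_≡_; _≢_)

get : ∀ {A : Set} {n} → Vec A n → ℕ → Maybe A
get []       _       = nothing
get (a ∷ v)  zero    = just a
get (a ∷ v)  (suc k) = get v k

-- 1-based character of a string at an integer position; nothing if the
-- position lies outside [1..n]
char : ∀ {A : Set} {n} → Vec A n → ℤ → Maybe A
char v (+[1+ k ]) = get v k
char v _          = nothing

module Grid {A : Set} (n : ℕ) (x y : Vec A n) where

  Vertex : ℕ → ℤ → Set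
  Vertex i d = i ≤ n × (ℤ.- (+ n) ℤ.≤ d) × (d ℤ.≤ + n)

  Match : ℕ → ℤ → Set
  Match i d = Σ A λ a → (char x (+ i) ≡ just a) × (char y (+ i ℤ.+ d) ≡ just a)

  data Step : ℕ → ℤ → ℕ → ℤ → ℕ → Set where
    del : ∀ {i d} → Vertex i d → Vertex (suc i) (d ℤ.- + 1) →
          Step i d (suc i) (d ℤ.- + 1) 1
    ins : ∀ {i d} → Vertex i d → Vertex i (d ℤ.+ + 1) →
          Step i d i (d ℤ.+ + 1) 1
    mat : ∀ {i d} {a} → Vertex i d → Vertex (suc i) d →
          char x (+ suc i) ≡ just a → char y (+ suc i ℤ.+ d) ≡ just a →
          Step i d (suc i) d 0
    sub : ∀ {i d} {a b} → Vertex i d → Vertex (suc i) d →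
          char x (+ suc i) ≡ just a → char y (+ suc i ℤ.+ d) ≡ just b →
          a ≢ b → Step i d (suc i) d 1

  data Reach : ℕ → ℤ → ℕ → Set where
    start : Vertex 0 (+ 0) → Reach 0 (+ 0) 0
    step  : ∀ {i d w i' d' e} → Reach i d w → Step i d i' d' e →
            Reach i' d' (w ℕ.+ e)

  Reachable : ℕ → ℤ → Set
  Reachable i d = ∃ λ w → Reach i d w

  -- c(i,d) = h : h is the minimum weight of a path from (0,0) to (i,d)
  Cost : ℕ → ℤ → ℕ → Set
  Cost i d h = Reach i d h × (∀ w → Reach i d w → h ≤ w)

  DominatedBy : ℕ → ℤ → ℕ → ℤ → Set
  DominatedBy i d i' d' = ∃ λ h → Cost i' d' h × Cost i d (suc h)

  -- potency, as an inductive predicate (the recursion is well founded in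
  -- the lexicographic order, so this is the recursive definition)
  data Potent : ℕ → ℤ → Set where
    potent : ∀ {i d} →
      (DominatedBy i d i (d ℤ.- + 1) →
         Potent i (d ℤ.- + 1) × ¬ Match (suc i) (d ℤ.- + 1)) →
      (∀ {i'} → i ≡ suc i' → DominatedBy i d i' (d ℤ.+ + 1) →
         Potent i' (d ℤ.+ + 1) × ¬ Match i (d ℤ.+ + 1)) →
      Potent i d

module Submission where

-- First c(i,d) ≤ c(i+1,d): a path to (i+1,d) can be cut back
-- to a path to (i,d) that is no heavier, by induction on the path, using
-- c(i,d) ≤ c(i,d+1) + 1 along the way and the leftmost diagonal d = -i (of cost i) at
-- the boundary. Second, if c(i+1,d) > c(i,d) = h then (i,d) is potent, by induction
-- on h: a dominator, (i,d-1) or (i-1,d+1), has cost h - 1 and reaches (i+1,d) by one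
-- insertion or deletion from the vertex just below it; so that vertex costs more than
-- h - 1, and a match there would reach (i+1,d) at cost h.

open import Defs
open import Data.Nat as ℕ using (ℕ; zero; suc; z≤n; _≤_; _<_)
import Data.Nat.Properties as ℕ
open import Data.Integer as ℤ using (ℤ; +_; -[1+_]; +≤+; -≤+)
import Data.Integer.Properties as ℤ
open import Data.Integer.Tactic.RingSolver using (solve-∀)
open import Data.Vec using (Vec)
open import Data.Product using (∃; _×_; _,_; proj₁; proj₂)
open import Data.Empty using (⊥-elim)
open import Relation.Nullary using (¬_; yes; no)
open import Relation.Binary.PropositionalEquality using (_≡_; refl; sym; subst; subst₂)

[d+1]-1≡d : ∀ d → d ℤ.+ + 1 ℤ.- + 1 ≡ d
[d+1]-1≡d = solve-∀

[d-1]+1≡d : ∀ d → d ℤ.- + 1 ℤ.+ + 1 ≡ d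
[d-1]+1≡d = solve-∀

-[k]-1≡-[1+k] : ∀ k → ℤ.- (+ k) ℤ.- + 1 ≡ -[1+ k ]
-[k]-1≡-[1+k] k = neg-minus-one (+ k)
  where
  neg-minus-one : ∀ a → ℤ.- a ℤ.- + 1 ≡ ℤ.- (+ 1 ℤ.+ a)
  neg-minus-one = solve-∀

-[k]≤d⇒-[1+k]≤d-1 : ∀ {k d} → ℤ.- (+ k) ℤ.≤ d → -[1+ k ] ℤ.≤ d ℤ.- + 1
-[k]≤d⇒-[1+k]≤d-1 {k} p = subst (ℤ._≤ _) (-[k]-1≡-[1+k] k) (ℤ.+-monoˡ-≤ (ℤ.- + 1) p)

-[1+k]≤d-1⇒-[k]≤d : ∀ {k d} → -[1+ k ] ℤ.≤ d ℤ.- + 1 → ℤ.- (+ k) ℤ.≤ d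
-[1+k]≤d-1⇒-[k]≤d {k} {d} p =
  subst₂ ℤ._≤_ (-[1+k]+1≡-[k] (+ k)) ([d-1]+1≡d d) (ℤ.+-monoˡ-≤ (+ 1) p)
  where
  -[1+k]+1≡-[k] : ∀ a → ℤ.- (+ 1 ℤ.+ a) ℤ.+ + 1 ≡ ℤ.- a
  -[1+k]+1≡-[k] = solve-∀

-[k]≤d⇒-[k]≤d+1 : ∀ {k d} → ℤ.- (+ k) ℤ.≤ d → ℤ.- (+ k) ℤ.≤ d ℤ.+ + 1
-[k]≤d⇒-[k]≤d+1 {d = d} p = ℤ.≤-trans p (ℤ.i≤i+j d (+ 1))

-[k]≤d⇒-[k′]≤d : ∀ {k k′ d} → k ≤ k′ → ℤ.- (+ k) ℤ.≤ d → ℤ.- (+ k′) ℤ.≤ d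
-[k]≤d⇒-[k′]≤d k≤k′ = ℤ.≤-trans (ℤ.neg-mono-≤ (+≤+ k≤k′))

leftmost-diagonal : ∀ {i d} → d ℤ.< ℤ.- (+ i) → ℤ.- (+ i) ℤ.≤ d ℤ.+ + 1 →
                    d ℤ.+ + 1 ≡ ℤ.- (+ i)
leftmost-diagonal {d = d} d<-i -i≤d+1 =
  ℤ.≤-antisym (subst (ℤ._≤ _) (ℤ.+-comm (+ 1) d) (ℤ.i<j⇒suc[i]≤j d<-i)) -i≤d+1

module GridProperties {A : Set} (n : ℕ) (x y : Vec A n) where
  open Grid n x y

  Reach⇒Vertex : ∀ {i d w} → Reach i d w → Vertex i d
  Reach⇒Vertex (start v)                = v
  Reach⇒Vertex (step _ (del _ v))       = v
  Reach⇒Vertex (step _ (ins _ v))       = v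
  Reach⇒Vertex (step _ (mat _ v _ _))   = v
  Reach⇒Vertex (step _ (sub _ v _ _ _)) = v

  -- i.e. the column i + d of a reachable vertex is nonnegative.
  Reach⇒column-bound : ∀ {i d w} → Reach i d w → ℤ.- (+ i) ℤ.≤ d
  Reach⇒column-bound (start _)                = ℤ.≤-refl
  Reach⇒column-bound (step r (del _ _))       = -[k]≤d⇒-[1+k]≤d-1 (Reach⇒column-bound r)
  Reach⇒column-bound (step r (ins _ _))       = -[k]≤d⇒-[k]≤d+1 (Reach⇒column-bound r)
  Reach⇒column-bound (step r (mat _ _ _ _))   = -[k]≤d⇒-[k′]≤d (ℕ.n≤1+n _) (Reach⇒column-bound r)
  Reach⇒column-bound (step r (sub _ _ _ _ _)) = -[k]≤d⇒-[k′]≤d (ℕ.n≤1+n _) (Reach⇒column-bound r)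

  -- Every unit that d drops below 0 is paid for by a deletion.
  Reach⇒weight-bound : ∀ {i d w} → Reach i d w → ℤ.- (+ w) ℤ.≤ d
  Reach⇒weight-bound (start _) = ℤ.≤-refl
  Reach⇒weight-bound (step {w = w} r (del _ _)) =
    -[k]≤d⇒-[k′]≤d (ℕ.≤-reflexive (ℕ.+-comm 1 w)) (-[k]≤d⇒-[1+k]≤d-1 (Reach⇒weight-bound r))
  Reach⇒weight-bound (step {w = w} r (ins _ _)) =
    -[k]≤d⇒-[k′]≤d (ℕ.m≤m+n w 1) (-[k]≤d⇒-[k]≤d+1 (Reach⇒weight-bound r))
  Reach⇒weight-bound (step {w = w} r (mat _ _ _ _)) =
    -[k]≤d⇒-[k′]≤d (ℕ.m≤m+n w 0) (Reach⇒weight-bound r)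
  Reach⇒weight-bound (step {w = w} r (sub _ _ _ _ _)) =
    -[k]≤d⇒-[k′]≤d (ℕ.m≤m+n w 1) (Reach⇒weight-bound r)

  reach-leftmost : ∀ i → i ≤ n → Reach i (ℤ.- (+ i)) i
  reach-leftmost zero    _   = start (z≤n , ℤ.neg-≤-pos , +≤+ z≤n)
  reach-leftmost (suc i) i<n =
    subst₂ (Reach (suc i)) (-[k]-1≡-[1+k] i) (ℕ.+-comm i 1)
      (step r (del (Reach⇒Vertex r) (subst (Vertex (suc i)) (sym (-[k]-1≡-[1+k] i)) v)))
    where
    r = reach-leftmost i (ℕ.<⇒≤ i<n)
    v : Vertex (suc i) -[1+ i ]
    v = i<n , ℤ.neg-mono-≤ (+≤+ i<n) , -≤+

  reach-lower-diagonal : ∀ {i e w} → Reach i e w →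
    Vertex i (e ℤ.- + 1) → ℤ.- (+ i) ℤ.≤ e ℤ.- + 1 →
    ∃ λ w′ → w′ ≤ w ℕ.+ 1 × Reach i (e ℤ.- + 1) w′
  reach-lower-diagonal (start _) _ ()
  reach-lower-diagonal (step r (del v v′)) vd@(_ , lo , _) col
    with reach-lower-diagonal r (proj₁ v , ℤ.≤-trans lo (ℤ.i-j≤i _ (+ 1)) , proj₂ (proj₂ v′))
                                (-[1+k]≤d-1⇒-[k]≤d col)
  ... | w′ , w′≤ , r′ = w′ ℕ.+ 1 , ℕ.+-monoˡ-≤ 1 w′≤ , step r′ (del (Reach⇒Vertex r′) vd)
  reach-lower-diagonal (step {w = w} r (ins _ _)) _ _ =
    w , ℕ.≤-trans (ℕ.m≤m+n w 1) (ℕ.m≤m+n (w ℕ.+ 1) 1) , subst (λ e → Reach _ e w) (sym ([d+1]-1≡d _)) r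
  reach-lower-diagonal (step {w = w} r (mat v _ _ _)) vd _ =
    w ℕ.+ 1 , ℕ.+-monoˡ-≤ 1 (ℕ.m≤m+n w 0) , step r (del v vd)
  reach-lower-diagonal (step {w = w} r (sub v _ _ _ _)) vd _ =
    w ℕ.+ 1 , ℕ.m≤m+n (w ℕ.+ 1) 1 , step r (del v vd)

  reach-previous-row : ∀ {i d w} → Reach (suc i) d w →
    Vertex i d → ℤ.- (+ i) ℤ.≤ d → ∃ λ w′ → w′ ≤ w × Reach i d w′
  reach-previous-row (step r (del _ _)) vd col = reach-lower-diagonal r vd col
  reach-previous-row {i} (step {w = w} r (ins v _)) vd col with ℤ.- (+ i) ℤ.≤? _
  ... | yes col′
    with reach-previous-row r (proj₁ vd , proj₁ (proj₂ v) , ℤ.≤-trans (ℤ.i≤i+j _ (+ 1)) (proj₂ (proj₂ vd)))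
                              col′
  ...   | w′ , w′≤w , r′ = w′ ℕ.+ 1 , ℕ.+-monoˡ-≤ 1 w′≤w , step r′ (ins (Reach⇒Vertex r′) vd)
  reach-previous-row {i} (step {w = w} r (ins v _)) vd col | no col′≰ =
    i , ℕ.≤-trans (ℕ.<⇒≤ i<w) (ℕ.m≤m+n w 1) ,
    subst (λ e → Reach i e i) (sym (leftmost-diagonal d<-i col)) (reach-leftmost i (proj₁ vd))
    where
    d<-i = ℤ.≰⇒> col′≰
    i<w : i < w
    i<w = ℤ.drop‿+<+ (ℤ.neg-cancel-< (ℤ.≤-<-trans (Reach⇒weight-bound r) d<-i))
  reach-previous-row (step {w = w} r (mat _ _ _ _))   _ _ = w , ℕ.m≤m+n w 0 , r
  reach-previous-row (step {w = w} r (sub _ _ _ _ _)) _ _ = w , ℕ.m≤m+n w 1 , r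

  reach-by-insertion : ∀ {i d w} → Vertex i d → Reach i (d ℤ.- + 1) w → Reach i d (w ℕ.+ 1)
  reach-by-insertion {i} {d} v r =
    subst (λ e → Reach i e _) ([d-1]+1≡d d)
      (step r (ins (Reach⇒Vertex r) (subst (Vertex i) (sym ([d-1]+1≡d d)) v)))

  reach-by-deletion : ∀ {i d w} → Vertex (suc i) d → Reach i (d ℤ.+ + 1) w → Reach (suc i) d (w ℕ.+ 1)
  reach-by-deletion {i} {d} v r =
    subst (λ e → Reach (suc i) e _) ([d+1]-1≡d d)
      (step r (del (Reach⇒Vertex r) (subst (Vertex (suc i)) (sym ([d+1]-1≡d d)) v)))

  Cost-unique : ∀ {i d h h′} → Cost i d h → Cost i d h′ → h ≡ h′
  Cost-unique (r , min) (r′ , min′) = ℕ.≤-antisym (min _ r′) (min′ _ r)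

  Cost-mono-row : ∀ {i d h h′} → Cost i d h → Cost (suc i) d h′ → h ≤ h′
  Cost-mono-row (r , min) (r′ , _) with reach-previous-row r′ (Reach⇒Vertex r) (Reach⇒column-bound r)
  ... | w , w≤h′ , r″ = ℕ.≤-trans (min w r″) w≤h′

  Cost-zero⇒¬DominatedBy : ∀ {i d i′ d′} → Cost i d 0 → ¬ DominatedBy i d i′ d′
  Cost-zero⇒¬DominatedBy C (_ , _ , C₁) with Cost-unique C C₁
  ... | ()

  DominatedBy⇒Cost : ∀ {i d i′ d′ h} → Cost i d (suc h) → DominatedBy i d i′ d′ → Cost i′ d′ h
  DominatedBy⇒Cost C (_ , C₀ , C₁) = subst (Cost _ _) (ℕ.suc-injective (Cost-unique C₁ C)) C₀

  PathsExceed : ℕ → ℤ → ℕ → Set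
  PathsExceed i d h = ∀ w → Reach i d w → h < w

  -- A match on the row below the dominator (a, b) would reach (i + 1, d) at cost h + 1 = c(i, d).
  dominator-bounds : ∀ {a b i d h} → a < n → Cost a b h →
    (∀ {w} → Reach (suc a) b w → Reach (suc i) d (w ℕ.+ 1)) →
    PathsExceed (suc i) d (suc h) → PathsExceed (suc a) b h × ¬ Match (suc a) b
  dominator-bounds {a} {b} {h = h} a<n (r , _) extend exceed = exceed′ , no-match
    where
    exceed′ : PathsExceed (suc a) b h
    exceed′ w r′ = ℕ.s<s⁻¹ (subst (suc h <_) (ℕ.+-comm w 1) (exceed _ (extend r′)))
    no-match : ¬ Match (suc a) b
    no-match (_ , xc , yc) =
      ℕ.<-irrefl (sym (ℕ.+-identityʳ h))
        (exceed′ _ (step r (mat (Reach⇒Vertex r) (a<n , proj₂ (Reach⇒Vertex r)) xc yc)))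

  -- Induction on the cost: a dominator has cost one less.
  potent-if-next-row-costlier : ∀ h {i d} → i < n → Cost i d h → PathsExceed (suc i) d h → Potent i d
  potent-if-next-row-costlier zero _ C _ =
    potent (λ D → ⊥-elim (Cost-zero⇒¬DominatedBy C D)) (λ _ D → ⊥-elim (Cost-zero⇒¬DominatedBy C D))
  potent-if-next-row-costlier (suc h) {i} {d} i<n C exceed =
    potent (λ D → from-dominator i<n (DominatedBy⇒Cost C D) (reach-by-insertion below) exceed)
           (from-above i<n C exceed)
    where
    below : Vertex (suc i) d
    below = i<n , proj₂ (Reach⇒Vertex (proj₁ C))

    from-dominator : ∀ {a b i d} → a < n → Cost a b h →
      (∀ {w} → Reach (suc a) b w → Reach (suc i) d (w ℕ.+ 1)) →
      PathsExceed (suc i) d (suc h) → Potent a b × ¬ Match (suc a) b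
    from-dominator a<n C₀ extend exceed with dominator-bounds a<n C₀ extend exceed
    ... | exceed₀ , no-match = potent-if-next-row-costlier h a<n C₀ exceed₀ , no-match

    from-above : ∀ {i d} → i < n → Cost i d (suc h) → PathsExceed (suc i) d (suc h) →
      ∀ {i′} → i ≡ suc i′ → DominatedBy i d i′ (d ℤ.+ + 1) →
      Potent i′ (d ℤ.+ + 1) × ¬ Match i (d ℤ.+ + 1)
    from-above i<n C exceed refl D =
      from-dominator (ℕ.<⇒≤ i<n) (DominatedBy⇒Cost C D)
        (reach-by-deletion (i<n , proj₂ (Reach⇒Vertex (proj₁ C)))) exceed

lemma3p3 : {A : Set} (n : ℕ) (x y : Vec A n) (i : ℕ) (d : ℤ) →
    i < n →
    Grid.Reachable n x y i d →
    Grid.Reachable n x y (suc i) d →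
    ¬ Grid.Potent n x y i d →
    ∀ h h′ → Grid.Cost n x y i d h → Grid.Cost n x y (suc i) d h′ → h′ ≡ h
lemma3p3 n x y i d i<n _ _ ¬potent h h′ C C′ = ℕ.≤-antisym h′≤h (Cost-mono-row C C′)
  where
  open GridProperties n x y
  h′≤h : h′ ≤ h
  h′≤h = ℕ.≮⇒≥ λ h<h′ →
    ¬potent (potent-if-next-row-costlier h i<n C (λ w r → ℕ.<-≤-trans h<h′ (proj₂ C′ w r)))
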